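{- Let $G$ be a connected threshold graph with block sequence $k_1,i_1,\ldots,k_m,i_m,k_{m+1}$, let $k=\sum_{p=1}^{m+1}k_p$, $i=\sum_{q=1}^m i_q$, and let $M=M(\alpha_1)$ be the matrix defined in the context, with $\alpha_1>0$ sufficiently large. Set $\alpha=a_1=\alpha_1+\sum_{q=1}^m i_q/\beta_q$. If $\lambda<0$ is the negative eigenvalue of $M$, then $\lambda<-k\alpha+i$. If $\lambda>0$ is a positive eigenvalue of $M$, then $\lambda\geq \beta_1^{ -1}>1/k$.
   Context: A graph is threshold if it is built from a single vertex by adding vertices one at a time, each new vertex being either a cone (joined to all previous vertices) or an isolate (joined to none); the first vertex counts as a cone. Grouping maximal runs of consecutive cones/isolates, a connected threshold graph has block sequence $k_1,i_1,\ldots,k_m,i_m,k_{m+1}$ (all entries $\geq1$, $m\geq1$): first $k_1$ cones, then $i_1$ isolates, ..., finally $k_{m+1}$ cones. Call $K_p$ the set of cones of the $p$-th cone block and $I_q$ the set of isolates of the $q$-th isolate block; a cone in $K_p$ and an isolate in $I_q$ are adjacent iff $q<p$. Definition of $M$: for $1\leq q\leq m$ let $\beta_q=k_{q+1}+\cdots+k_{m+1}$ and $b_q=1/\beta_q$; for $1\leq p\leq m+1$ let $a_p=\alpha_1+\sum_{s=p}^{m} i_s b_s$. $M$ is the symmetric matrix indexed by $V(G)$ with: $M_{uv}=-a_{\min(p,p')}$ for $u\in K_p$, $v\in K_{p'}$ (including $u=v$); $M_{uv}=-b_q$ if $u\in K_p$, $v\in I_q$ with $q<p$, and $0$ if $q\geq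 p$; $M_{uu}=b_q$ for $u\in I_q$; $M_{uv}=0$ for distinct isolates. For $\alpha_1$ sufficiently large $M$ has exactly one negative eigenvalue. -}

module Defs where

open import Level using (0ℓ)
open import Data.Nat as ℕ using (ℕ; zero; suc)
import Data.Nat.Properties as ℕP
open import Data.Fin as Fin using (Fin; toℕ)
import Data.Fin.Properties as FinP
open import Data.Product using (Σ; _×_; _,_; ∃; proj₁)
open import Data.Sum using (_⊎_; inj₁; inj₂)
open import Data.Bool using (Bool; true; false; if_then_else_)
open import Relation.Nullary using (¬_; Dec; yes; no)
open import Relation.Nullary.Decidable using (⌊_⌋)
open import Relation.Binary.PropositionalEquality using (_≡_; _≢_; refl)
open import Algebra.Structures using (IsCommutativeRing)
open import Relation.Binary.Structures using (IsStrictTotalOrder)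

-- The real numbers, axiomatised as a complete ordered field.
-- (agda-stdlib has no real numbers.)  The multiplicative inverse is
-- total, with the field axiom only for nonzero arguments.

record Reals : Set₁ where
  infixl 6 _+_
  infixl 7 _*_
  infix  4 _<_
  field
    Carrier : Set
    0# 1#   : Carrier
    _+_ _*_ : Carrier → Carrier → Carrier
    -_      : Carrier → Carrier
    _⁻¹     : Carrier → Carrier
    _<_     : Carrier → Carrier → Set
    isCommutativeRing : IsCommutativeRing _≡_ _+_ _*_ -_ 0# 1#
    0≢1     : 0# ≢ 1#
    ⁻¹-inverse : ∀ x → x ≢ 0# → x * (x ⁻¹) ≡ 1#
    isStrictTotalOrder : IsStrictTotalOrder _≡_ _<_
    +-mono-<  : ∀ {x y} z → x < y → x + z < y + z
    *-pos     : ∀ {x y} → 0# < x → 0# < y → 0# < x * y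
    completeness : (P : Carrier → Set) → (∃ λ x → P x) →
                   (∃ λ u → ∀ x → P x → ¬ (u < x)) →
                   ∃ λ s → (∀ x → P x → ¬ (s < x)) ×
                           (∀ u → (∀ x → P x → ¬ (u < x)) → ¬ (u < s))

  _≤_ : Carrier → Carrier → Set
  x ≤ y = (x < y) ⊎ (x ≡ y)

  _-_ : Carrier → Carrier → Carrier
  x - y = x + (- y)

  fromℕ : ℕ → Carrier
  fromℕ zero    = 0#
  fromℕ (suc n) = 1# + fromℕ n

  sumFin : (n : ℕ) → (Fin n → Carrier) → Carrier
  sumFin zero    f = 0#
  sumFin (suc n) f = f Fin.zero + sumFin n (λ j → f (Fin.suc j))

sumℕ : (n : ℕ) → (Fin n → ℕ) → ℕ
sumℕ zero    f = 0
sumℕ (suc n) f = f Fin.zero ℕ.+ sumℕ n (λ j → f (Fin.suc j))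

-- Block sequence k_1,i_1,…,k_m,i_m,k_{m+1}, indexed 0-based:
--   ks : Fin (suc m) → ℕ   (ks p  = k_{p+1}),
--   is : Fin m → ℕ         (is q  = i_{q+1}).
-- The 1-based condition q < p is the same as toℕ q < toℕ p.

-- vertex set V(G): cones (p , j) with j < k_p, isolates (q , j) with j < i_q
Vertex : (m : ℕ) → (Fin (suc m) → ℕ) → (Fin m → ℕ) → Set
Vertex m ks is = (Σ (Fin (suc m)) λ p → Fin (ks p)) ⊎ (Σ (Fin m) λ q → Fin (is q))

β : (m : ℕ) → (Fin (suc m) → ℕ) → Fin m → ℕ
β m ks q = sumℕ (suc m) (λ p → if ⌊ toℕ q ℕ.<? toℕ p ⌋ then ks p else 0)

kTot : (m : ℕ) → (Fin (suc m) → ℕ) → ℕ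
kTot m ks = sumℕ (suc m) ks

iTot : (m : ℕ) → (Fin m → ℕ) → ℕ
iTot m is = sumℕ m is

sameIso : (m : ℕ) (is : Fin m → ℕ) → (Σ (Fin m) λ q → Fin (is q)) →
          (Σ (Fin m) λ q → Fin (is q)) → Bool
sameIso m is (q , j) (q' , j') with q Fin.≟ q'
... | no _ = false
... | yes refl = ⌊ j Fin.≟ j' ⌋

module _ (R : Reals) where
  open Reals R

  b : (m : ℕ) → (Fin (suc m) → ℕ) → Fin m → Carrier
  b m ks q = (fromℕ (β m ks q)) ⁻¹

  a : (m : ℕ) → (Fin (suc m) → ℕ) → (Fin m → ℕ) → Carrier → Fin (suc m) → Carrier
  a m ks is α₁ p =
    α₁ + sumFin m (λ s → if ⌊ toℕ p ℕ.≤? toℕ s ⌋ then fromℕ (is s) * b m ks s else 0#)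

  minFin : ∀ {n} → Fin n → Fin n → Fin n
  minFin p p' = if ⌊ toℕ p ℕ.≤? toℕ p' ⌋ then p else p'

  M : (m : ℕ) (ks : Fin (suc m) → ℕ) (is : Fin m → ℕ) → Carrier →
      Vertex m ks is → Vertex m ks is → Carrier
  M m ks is α₁ (inj₁ (p , _)) (inj₁ (p' , _)) = - a m ks is α₁ (minFin p p')
  M m ks is α₁ (inj₁ (p , _)) (inj₂ (q , _)) =
    if ⌊ toℕ q ℕ.<? toℕ p ⌋ then - b m ks q else 0#
  M m ks is α₁ (inj₂ (q , _)) (inj₁ (p , _)) =
    if ⌊ toℕ q ℕ.<? toℕ p ⌋ then - b m ks q else 0#
  M m ks is α₁ (inj₂ u) (inj₂ v) =
    if sameIso m is u v then b m ks (proj₁ u) else 0#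

  sumV : (m : ℕ) (ks : Fin (suc m) → ℕ) (is : Fin m → ℕ) →
         (Vertex m ks is → Carrier) → Carrier
  sumV m ks is f =
    sumFin (suc m) (λ p → sumFin (ks p) (λ j → f (inj₁ (p , j)))) +
    sumFin m (λ q → sumFin (is q) (λ j → f (inj₂ (q , j))))

  IsEigenvalue : (m : ℕ) (ks : Fin (suc m) → ℕ) (is : Fin m → ℕ) →
                 (Vertex m ks is → Vertex m ks is → Carrier) → Carrier → Set
  IsEigenvalue m ks is A λ′ =
    Σ (Vertex m ks is → Carrier) λ v →
      (Σ (Vertex m ks is) λ u → v u ≢ 0#) ×
      (∀ u → sumV m ks is (λ w → A u w * v w) ≡ λ′ * v u)

{-# OPTIONS --safe #-}
-- An eigenvector of M for an eigenvalue λ ≠ 0 is constant, say c_p, on each cone block K_p.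
-- With Z_q the sum of the eigenvector over I_q and T_p = Σ_{p′ ≥ p} k_{p′} c_{p′}, the
-- eigen-equations reduce to
--   λ c_1 = −α T_1,   c_{q+1} = c_q − Z_q,   Z_q (b_q − λ) = i_q b_q T_{q+1}.
-- If λ < b_q for every q, these propagate the sign of c_{m+1} down to every c_p and Z_q, and
-- c_{m+1} = 0 would force the eigenvector to vanish; so up to sign all c_p and Z_q are positive.
-- For λ > 0 this contradicts λ c_1 = −α T_1 < 0, hence λ ≥ min_q b_q = b_1 = 1/(k − k_1) > 1/k.
-- For λ < 0 the condition λ < b_q is automatic, and multiplying the isolate equations by
-- β_q = 1/b_q and summing gives, since Σ_q β_q Z_q = k c_1 − T_1 telescopes,
--   (λ + kα − i) T_1 = −Σ_q (Z_q + i_q (T_1 − T_{q+1})) < 0.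

module Submission where

open import Defs
open import Level using (0ℓ)
open import Function using (_∘_)
open import Data.Nat as ℕ using (ℕ; zero; suc) renaming (_≤_ to _≤ℕ_)
import Data.Nat.Properties as ℕ
open import Data.Integer as ℤ using (ℤ; -[1+_]; _⊖_)
import Data.Integer.Properties as ℤ
import Data.Sign as Sign
open import Data.Fin as Fin using (Fin; zero; suc; toℕ; fromℕ<; inject₁)
import Data.Fin.Properties as Fin
open import Data.Fin.Induction using (>-weakInduction)
open import Data.Maybe using (Maybe; just; nothing)
open import Data.Product using (Σ; _×_; _,_; proj₁)
open import Data.Sum using (inj₁; inj₂)
open import Data.Bool using (Bool; true; false; if_then_else_)
open import Relation.Nullary using (¬_; Dec; yes; no; contradiction)
open import Relation.Nullary.Decidable using (⌊_⌋; dec-true; dec-false; isYes≗does)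
open import Relation.Binary.Bundles using (StrictTotalOrder)
open import Relation.Binary.Definitions using (tri<; tri≈; tri>)
open import Relation.Binary.PropositionalEquality
open import Algebra.Bundles using (CommutativeRing)
import Algebra.Properties.Ring as RingProperties
import Algebra.Solver.Ring.AlmostCommutativeRing as ACR
import Algebra.Solver.Ring as RingSolver
import Relation.Binary.Properties.StrictTotalOrder as StrictTotalOrderProperties
import Relation.Binary.Reasoning.StrictPartialOrder as StrictReasoning

⌊⌋-true : ∀ {A : Set} (a? : Dec A) → A → ⌊ a? ⌋ ≡ true
⌊⌋-true a? a = trans (isYes≗does a?) (dec-true a? a)

⌊⌋-false : ∀ {A : Set} (a? : Dec A) → ¬ A → ⌊ a? ⌋ ≡ false
⌊⌋-false a? ¬a = trans (isYes≗does a?) (dec-false a? ¬a)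

module OrderedField (R : Reals) where
  open Reals R

  commutativeRing : CommutativeRing 0ℓ 0ℓ
  commutativeRing = record { isCommutativeRing = isCommutativeRing }

  open CommutativeRing commutativeRing public
    using ( +-assoc; +-comm; +-identityˡ; +-identityʳ; *-assoc; *-comm; *-identityˡ; *-identityʳ
          ; distribˡ; distribʳ; zeroˡ; zeroʳ; -‿inverseˡ; -‿inverseʳ; ring)
  open RingProperties ring public
    using (-‿involutive; -‿distribˡ-*; -‿distribʳ-*; -0#≈0#; -‿anti-homo-+; ⁻¹-anti-homo‿-; xyx⁻¹≈y)

  fromℕ-+ : ∀ m n → fromℕ (m ℕ.+ n) ≡ fromℕ m + fromℕ n
  fromℕ-+ zero    n = sym (+-identityˡ _)
  fromℕ-+ (suc m) n = trans (cong (1# +_) (fromℕ-+ m n)) (sym (+-assoc _ _ _))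

  fromℕ-* : ∀ m n → fromℕ (m ℕ.* n) ≡ fromℕ m * fromℕ n
  fromℕ-* zero    n = sym (zeroˡ _)
  fromℕ-* (suc m) n = begin
    fromℕ (n ℕ.+ m ℕ.* n)            ≡⟨ fromℕ-+ n (m ℕ.* n) ⟩
    fromℕ n + fromℕ (m ℕ.* n)        ≡⟨ cong₂ _+_ (sym (*-identityˡ _)) (fromℕ-* m n) ⟩
    1# * fromℕ n + fromℕ m * fromℕ n ≡⟨ distribʳ _ _ _ ⟨
    (1# + fromℕ m) * fromℕ n         ∎
    where open ≡-Reasoning

  -- The ring solver below works with integer coefficients, interpreted in R along fromℤ.
  fromℤ : ℤ → Carrier
  fromℤ (ℤ.+ n)    = fromℕ n
  fromℤ -[1+ n ] = - fromℕ (suc n)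

  fromℤ-⊖ : ∀ m n → fromℤ (m ⊖ n) ≡ fromℕ m - fromℕ n
  fromℤ-⊖ zero    zero    = sym (-‿inverseʳ 0#)
  fromℤ-⊖ zero    (suc n) = sym (+-identityˡ _)
  fromℤ-⊖ (suc m) zero    = sym (trans (cong (fromℕ (suc m) +_) -0#≈0#) (+-identityʳ _))
  fromℤ-⊖ (suc m) (suc n) = begin
    fromℤ (suc m ⊖ suc n)               ≡⟨ cong fromℤ (ℤ.[1+m]⊖[1+n]≡m⊖n m n) ⟩
    fromℤ (m ⊖ n)                       ≡⟨ fromℤ-⊖ m n ⟩
    fromℕ m - fromℕ n                       ≡⟨ xyx⁻¹≈y 1# _ ⟨
    (1# + (fromℕ m - fromℕ n)) - 1#         ≡⟨ cong (_- 1#) (+-assoc 1# (fromℕ m) _) ⟨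
    ((1# + fromℕ m) - fromℕ n) - 1#         ≡⟨ +-assoc _ _ _ ⟩
    (1# + fromℕ m) + ((- fromℕ n) - 1#)     ≡⟨ cong ((1# + fromℕ m) +_) (-‿anti-homo-+ 1# (fromℕ n)) ⟨
    (1# + fromℕ m) - (1# + fromℕ n)     ∎
    where open ≡-Reasoning

  fromℤ-neg : ∀ i → fromℤ (ℤ.- i) ≡ - fromℤ i
  fromℤ-neg (ℤ.+ zero)  = sym -0#≈0#
  fromℤ-neg (ℤ.+ suc n) = refl
  fromℤ-neg -[1+ n ]  = sym (-‿involutive _)

  fromℤ-+ : ∀ i j → fromℤ (i ℤ.+ j) ≡ fromℤ i + fromℤ j
  fromℤ-+ -[1+ m ] -[1+ n ] = begin
    - fromℕ (suc (suc (m ℕ.+ n)))      ≡⟨ cong (-_ ∘ fromℕ) (ℕ.+-suc (suc m) n) ⟨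
    - fromℕ (suc m ℕ.+ suc n)          ≡⟨ cong -_ (fromℕ-+ (suc m) (suc n)) ⟩
    - (fromℕ (suc m) + fromℕ (suc n))  ≡⟨ -‿anti-homo-+ _ _ ⟩
    (- fromℕ (suc n)) - fromℕ (suc m)  ≡⟨ +-comm _ _ ⟩
    (- fromℕ (suc m)) - fromℕ (suc n)  ∎
    where open ≡-Reasoning
  fromℤ-+ -[1+ m ] (ℤ.+ n)    = trans (fromℤ-⊖ n (suc m)) (+-comm _ _)
  fromℤ-+ (ℤ.+ m)    -[1+ n ] = fromℤ-⊖ m (suc n)
  fromℤ-+ (ℤ.+ m)    (ℤ.+ n)    = fromℕ-+ m n

  fromℤ-+◃ : ∀ n → fromℤ (Sign.+ ℤ.◃ n) ≡ fromℕ n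
  fromℤ-+◃ zero    = refl
  fromℤ-+◃ (suc n) = refl

  fromℤ--◃ : ∀ n → fromℤ (Sign.- ℤ.◃ n) ≡ - fromℕ n
  fromℤ--◃ zero    = sym -0#≈0#
  fromℤ--◃ (suc n) = refl

  -x*-y≡x*y : ∀ x y → - x * - y ≡ x * y
  -x*-y≡x*y x y = begin
    - x * - y      ≡⟨ -‿distribˡ-* x (- y) ⟨
    - (x * - y)    ≡⟨ cong -_ (-‿distribʳ-* x y) ⟨
    - - (x * y)    ≡⟨ -‿involutive _ ⟩
    x * y          ∎
    where open ≡-Reasoning

  fromℤ-* : ∀ i j → fromℤ (i ℤ.* j) ≡ fromℤ i * fromℤ j
  fromℤ-* (ℤ.+ m)    (ℤ.+ n)    = trans (fromℤ-+◃ (m ℕ.* n)) (fromℕ-* m n)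
  fromℤ-* (ℤ.+ m)    -[1+ n ] =
    trans (fromℤ--◃ (m ℕ.* suc n)) (trans (cong -_ (fromℕ-* m (suc n))) (-‿distribʳ-* _ _))
  fromℤ-* -[1+ m ] (ℤ.+ n)    =
    trans (fromℤ--◃ (suc m ℕ.* n)) (trans (cong -_ (fromℕ-* (suc m) n)) (-‿distribˡ-* _ _))
  fromℤ-* -[1+ m ] -[1+ n ] =
    trans (fromℤ-+◃ (suc m ℕ.* suc n)) (trans (fromℕ-* (suc m) (suc n)) (sym (-x*-y≡x*y _ _)))

  almostCommutativeRing : ACR.AlmostCommutativeRing 0ℓ 0ℓ
  almostCommutativeRing = ACR.fromCommutativeRing commutativeRing

  fromℤ-homomorphism : ℤ.+-*-rawRing ACR.-Raw-AlmostCommutative⟶ almostCommutativeRing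
  fromℤ-homomorphism = record
    { ⟦_⟧ = fromℤ ; +-homo = fromℤ-+ ; *-homo = fromℤ-* ; -‿homo = fromℤ-neg
    ; 0-homo = refl ; 1-homo = +-identityʳ 1# }

  fromℤ-≟ : ∀ i j → Maybe (fromℤ i ≡ fromℤ j)
  fromℤ-≟ i j with i ℤ.≟ j
  ... | yes i≡j = just (cong fromℤ i≡j)
  ... | no  _   = nothing

  open RingSolver ℤ.+-*-rawRing almostCommutativeRing fromℤ-homomorphism fromℤ-≟ public
    using (solve; _:+_; _:*_; :-_; _:-_; _:=_)


  strictTotalOrder : StrictTotalOrder 0ℓ 0ℓ 0ℓ
  strictTotalOrder = record { isStrictTotalOrder = isStrictTotalOrder }

  open StrictTotalOrder strictTotalOrder public
    using (compare; irrefl; asym; strictPartialOrder) renaming (trans to <-trans)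
  open StrictTotalOrderProperties strictTotalOrder public using () renaming (trans to ≤-trans)

  <⇒≢ : ∀ {x y} → x < y → x ≢ y
  <⇒≢ x<y x≡y = irrefl x≡y x<y

  <-≤-trans : ∀ {x y z} → x < y → y ≤ z → x < z
  <-≤-trans x<y (inj₁ y<z)  = <-trans x<y y<z
  <-≤-trans x<y (inj₂ refl) = x<y

  ≮⇒≥ : ∀ {x y} → ¬ (x < y) → y ≤ x
  ≮⇒≥ {x} {y} x≮y with compare x y
  ... | tri< x<y _ _   = contradiction x<y x≮y
  ... | tri≈ _ x≡y _   = inj₂ (sym x≡y)
  ... | tri> _ _ y<x   = inj₁ y<x

  x<y⇒0<y-x : ∀ {x y} → x < y → 0# < y - x
  x<y⇒0<y-x {x} {y} x<y = subst (_< y - x) (-‿inverseʳ x) (+-mono-< (- x) x<y)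

  0<y-x⇒x<y : ∀ {x y} → 0# < y - x → x < y
  0<y-x⇒x<y {x} {y} 0<y-x =
    subst₂ _<_ (+-identityˡ x) (solve 2 (λ x y → (y :- x) :+ x := y) refl x y) (+-mono-< x 0<y-x)

  0<x⇒-x<0 : ∀ {x} → 0# < x → - x < 0#
  0<x⇒-x<0 {x} 0<x = subst₂ _<_ (+-identityˡ (- x)) (-‿inverseʳ x) (+-mono-< (- x) 0<x)

  x<0⇒0<-x : ∀ {x} → x < 0# → 0# < - x
  x<0⇒0<-x {x} x<0 = subst₂ _<_ (-‿inverseʳ x) (+-identityˡ (- x)) (+-mono-< (- x) x<0)

  +-nonneg-pos : ∀ {x y} → 0# ≤ x → 0# < y → 0# < x + y
  +-nonneg-pos {x} {y} (inj₁ 0<x) 0<y = <-trans 0<y (subst (_< x + y) (+-identityˡ y) (+-mono-< y 0<x))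
  +-nonneg-pos {y = y} (inj₂ refl) 0<y = subst (0# <_) (sym (+-identityˡ y)) 0<y

  +-pos-nonneg : ∀ {x y} → 0# < x → 0# ≤ y → 0# < x + y
  +-pos-nonneg {x} {y} 0<x 0≤y = subst (0# <_) (+-comm y x) (+-nonneg-pos 0≤y 0<x)

  +-pos : ∀ {x y} → 0# < x → 0# < y → 0# < x + y
  +-pos 0<x 0<y = +-pos-nonneg 0<x (inj₁ 0<y)

  +-nonneg : ∀ {x y} → 0# ≤ x → 0# ≤ y → 0# ≤ (x + y)
  +-nonneg 0≤x (inj₁ 0<y)      = inj₁ (+-nonneg-pos 0≤x 0<y)
  +-nonneg {x} 0≤x (inj₂ refl) = subst (0# ≤_) (sym (+-identityʳ x)) 0≤x

  +-mono-≤ : ∀ {x y u w} → x ≤ y → u ≤ w → (x + u) ≤ (y + w)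
  +-mono-≤ {x} {y} {u} {w} x≤y u≤w = ≤-trans (right x≤y) (subst₂ _≤_ (+-comm u y) (+-comm w y) (right u≤w))
    where
    right : ∀ {x y z} → x ≤ y → (x + z) ≤ (y + z)
    right (inj₁ x<y)  = inj₁ (+-mono-< _ x<y)
    right (inj₂ refl) = inj₂ refl

  *-nonneg : ∀ {x y} → 0# ≤ x → 0# ≤ y → 0# ≤ (x * y)
  *-nonneg (inj₁ 0<x) (inj₁ 0<y)  = inj₁ (*-pos 0<x 0<y)
  *-nonneg {x} _ (inj₂ refl)      = inj₂ (sym (zeroʳ x))
  *-nonneg {y = y} (inj₂ refl) _  = inj₂ (sym (zeroˡ y))

  *-pos-neg : ∀ {x y} → 0# < x → y < 0# → x * y < 0#
  *-pos-neg {x} {y} 0<x y<0 =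
    subst (_< 0#) (-‿involutive _) (0<x⇒-x<0 (subst (0# <_) (sym (-‿distribʳ-* x y)) (*-pos 0<x (x<0⇒0<-x y<0))))

  *-pos-cancelˡ : ∀ {x y} → 0# < x → 0# < x * y → 0# < y
  *-pos-cancelˡ {x} {y} 0<x 0<xy with compare 0# y
  ... | tri< 0<y _ _  = 0<y
  ... | tri≈ _ refl _ = contradiction (subst (0# <_) (zeroʳ x) 0<xy) (irrefl refl)
  ... | tri> _ _ y<0  = contradiction 0<xy (asym (*-pos-neg 0<x y<0))

  *-neg-cancelʳ : ∀ {x y} → 0# < y → x * y < 0# → x < 0#
  *-neg-cancelʳ {x} {y} 0<y xy<0 with compare x 0#
  ... | tri< x<0 _ _  = x<0
  ... | tri≈ _ refl _ = contradiction (subst (_< 0#) (zeroˡ y) xy<0) (irrefl refl)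
  ... | tri> _ _ 0<x  = contradiction xy<0 (asym (*-pos 0<x 0<y))

  0<1 : 0# < 1#
  0<1 with compare 0# 1#
  ... | tri< 0<1 _ _ = 0<1
  ... | tri≈ _ 0≡1 _ = contradiction 0≡1 0≢1
  ... | tri> _ _ 1<0 = contradiction 0<1*1 (asym 1<0)
    where
    0<1*1 : 0# < 1#
    0<1*1 = subst (0# <_) (trans (-x*-y≡x*y 1# 1#) (*-identityˡ 1#)) (*-pos (x<0⇒0<-x 1<0) (x<0⇒0<-x 1<0))

  0≤fromℕ : ∀ n → 0# ≤ fromℕ n
  0≤fromℕ zero    = inj₂ refl
  0≤fromℕ (suc n) = inj₁ (+-pos-nonneg 0<1 (0≤fromℕ n))

  0<fromℕ : ∀ {n} → 1 ≤ℕ n → 0# < fromℕ n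
  0<fromℕ {suc n} _ = +-pos-nonneg 0<1 (0≤fromℕ n)

  0<x⇒x≢0 : ∀ {x} → 0# < x → x ≢ 0#
  0<x⇒x≢0 0<x x≡0 = irrefl (sym x≡0) 0<x

  *-cancelˡ : ∀ {x y z} → x ≢ 0# → x * y ≡ x * z → y ≡ z
  *-cancelˡ {x} {y} {z} x≢0 xy≡xz = begin
    y                ≡⟨ *-identityˡ y ⟨
    1# * y           ≡⟨ cong (_* y) x⁻¹x≡1 ⟨
    (x ⁻¹ * x) * y   ≡⟨ *-assoc _ _ _ ⟩
    x ⁻¹ * (x * y)   ≡⟨ cong (x ⁻¹ *_) xy≡xz ⟩
    x ⁻¹ * (x * z)   ≡⟨ *-assoc _ _ _ ⟨
    (x ⁻¹ * x) * z   ≡⟨ cong (_* z) x⁻¹x≡1 ⟩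
    1# * z           ≡⟨ *-identityˡ z ⟩
    z                ∎
    where
    open ≡-Reasoning
    x⁻¹x≡1 : x ⁻¹ * x ≡ 1#
    x⁻¹x≡1 = trans (*-comm _ _) (⁻¹-inverse x x≢0)

  ⁻¹-pos : ∀ {x} → 0# < x → 0# < x ⁻¹
  ⁻¹-pos {x} 0<x = *-pos-cancelˡ 0<x (subst (0# <_) (sym (⁻¹-inverse x (0<x⇒x≢0 0<x))) 0<1)

  ⁻¹-antitone : ∀ {x y} → 0# < x → x < y → y ⁻¹ < x ⁻¹
  ⁻¹-antitone {x} {y} 0<x x<y =
    0<y-x⇒x<y (subst (0# <_) eq (*-pos (x<y⇒0<y-x x<y) (*-pos (⁻¹-pos 0<x) (⁻¹-pos 0<y))))
    where
    open ≡-Reasoning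
    0<y = <-trans 0<x x<y
    eq : (y - x) * (x ⁻¹ * y ⁻¹) ≡ (x ⁻¹) - (y ⁻¹)
    eq = begin
      (y - x) * (x ⁻¹ * y ⁻¹)
        ≡⟨ solve 4 (λ x y x′ y′ → (y :- x) :* (x′ :* y′) := (y :* y′) :* x′ :- (x :* x′) :* y′)
                   refl x y (x ⁻¹) (y ⁻¹) ⟩
      ((y * y ⁻¹) * x ⁻¹) - ((x * x ⁻¹) * y ⁻¹)
        ≡⟨ cong₂ (λ s t → (s * x ⁻¹) - (t * y ⁻¹))
                 (⁻¹-inverse y (0<x⇒x≢0 0<y)) (⁻¹-inverse x (0<x⇒x≢0 0<x)) ⟩
      (1# * x ⁻¹) - (1# * y ⁻¹)
        ≡⟨ cong₂ _-_ (*-identityˡ _) (*-identityˡ _) ⟩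
      (x ⁻¹) - (y ⁻¹)                                ∎

  x≤y⇒0≤y-x : ∀ {x y} → x ≤ y → 0# ≤ (y - x)
  x≤y⇒0≤y-x (inj₁ x<y)  = inj₁ (x<y⇒0<y-x x<y)
  x≤y⇒0≤y-x (inj₂ refl) = inj₂ (sym (-‿inverseʳ _))

  ⁻¹-antitone-≤ : ∀ {x y} → 0# < x → x ≤ y → (y ⁻¹) ≤ (x ⁻¹)
  ⁻¹-antitone-≤ 0<x (inj₁ x<y)  = inj₁ (⁻¹-antitone 0<x x<y)
  ⁻¹-antitone-≤ 0<x (inj₂ refl) = inj₂ refl

module FiniteSums (R : Reals) where
  open Reals R
  open OrderedField R

  sumFin-cong : ∀ n {f g : Fin n → Carrier} → (∀ i → f i ≡ g i) → sumFin n f ≡ sumFin n g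
  sumFin-cong zero    f≗g = refl
  sumFin-cong (suc n) f≗g = cong₂ _+_ (f≗g zero) (sumFin-cong n (f≗g ∘ suc))

  sumFin-+ : ∀ n (f g : Fin n → Carrier) → sumFin n (λ i → f i + g i) ≡ sumFin n f + sumFin n g
  sumFin-+ zero    f g = sym (+-identityˡ 0#)
  sumFin-+ (suc n) f g = trans (cong (f zero + g zero +_) (sumFin-+ n (f ∘ suc) (g ∘ suc)))
    (solve 4 (λ a b c d → (a :+ b) :+ (c :+ d) := (a :+ c) :+ (b :+ d)) refl _ _ _ _)

  sumFin-*ˡ : ∀ n x (f : Fin n → Carrier) → sumFin n (λ i → x * f i) ≡ x * sumFin n f
  sumFin-*ˡ zero    x f = sym (zeroʳ x)
  sumFin-*ˡ (suc n) x f = trans (cong (x * f zero +_) (sumFin-*ˡ n x (f ∘ suc))) (sym (distribˡ x _ _))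

  sumFin-neg : ∀ n (f : Fin n → Carrier) → sumFin n (λ i → - f i) ≡ - sumFin n f
  sumFin-neg zero    f = sym -0#≈0#
  sumFin-neg (suc n) f = trans (cong (- f zero +_) (sumFin-neg n (f ∘ suc)))
    (solve 2 (λ a b → :- a :+ :- b := :- (a :+ b)) refl _ _)

  sumFin-const : ∀ n x → sumFin n (λ _ → x) ≡ fromℕ n * x
  sumFin-const zero    x = sym (zeroˡ x)
  sumFin-const (suc n) x = trans (cong (x +_) (sumFin-const n x))
    (sym (trans (distribʳ x 1# (fromℕ n)) (cong (_+ fromℕ n * x) (*-identityˡ x))))

  sumFin-zero : ∀ n → sumFin n (λ _ → 0#) ≡ 0#
  sumFin-zero n = trans (sumFin-const n 0#) (zeroʳ _)

  sumFin-δ : ∀ n (i : Fin n) (f : Fin n → Carrier) → (∀ j → j ≢ i → f j ≡ 0#) → sumFin n f ≡ f i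
  sumFin-δ (suc n) zero    f f≡0 =
    trans (cong (f zero +_) (trans (sumFin-cong n (λ j → f≡0 (suc j) λ ())) (sumFin-zero n))) (+-identityʳ _)
  sumFin-δ (suc n) (suc i) f f≡0 =
    trans (cong (_+ sumFin n (f ∘ suc)) (f≡0 zero λ ()))
      (trans (+-identityˡ _) (sumFin-δ n i (f ∘ suc) (λ j j≢i → f≡0 (suc j) (j≢i ∘ Fin.suc-injective))))

  sumFin-nonneg : ∀ n (f : Fin n → Carrier) → (∀ i → 0# ≤ f i) → 0# ≤ sumFin n f
  sumFin-nonneg zero    f 0≤f = inj₂ refl
  sumFin-nonneg (suc n) f 0≤f = +-nonneg (0≤f zero) (sumFin-nonneg n (f ∘ suc) (0≤f ∘ suc))

  sumFin-pos : ∀ {n} → 1 ≤ℕ n → (f : Fin n → Carrier) → (∀ i → 0# < f i) → 0# < sumFin n f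
  sumFin-pos {suc n} _ f 0<f = +-pos-nonneg (0<f zero) (sumFin-nonneg n (f ∘ suc) (inj₁ ∘ 0<f ∘ suc))

  sumFin-mono : ∀ n (f g : Fin n → Carrier) → (∀ i → f i ≤ g i) → sumFin n f ≤ sumFin n g
  sumFin-mono zero    f g f≤g = inj₂ refl
  sumFin-mono (suc n) f g f≤g = +-mono-≤ (f≤g zero) (sumFin-mono n (f ∘ suc) (g ∘ suc) (f≤g ∘ suc))

  sumFin-telescope : ∀ n (h : Fin (suc n) → Carrier) →
    sumFin n (λ i → h (suc i) - h (inject₁ i)) ≡ h (Fin.fromℕ n) - h zero
  sumFin-telescope zero    h = sym (-‿inverseʳ _)
  sumFin-telescope (suc n) h = trans (cong ((h (suc zero) - h zero) +_) (sumFin-telescope n (h ∘ suc)))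
    (solve 3 (λ a b c → (b :- a) :+ (c :- b) := c :- a) refl _ _ _)

  fromℕ-sumℕ : ∀ n (f : Fin n → ℕ) → fromℕ (sumℕ n f) ≡ sumFin n (fromℕ ∘ f)
  fromℕ-sumℕ zero    f = refl
  fromℕ-sumℕ (suc n) f = trans (fromℕ-+ (f zero) _) (cong (fromℕ (f zero) +_) (fromℕ-sumℕ n (f ∘ suc)))

  if-*ˡ : ∀ (t : Bool) (y w : Carrier) → (if t then y else 0#) * w ≡ (if t then y * w else 0#)
  if-*ˡ true  y w = refl
  if-*ˡ false y w = zeroˡ w

  if-*ʳ : ∀ (t : Bool) (y w : Carrier) → y * (if t then w else 0#) ≡ (if t then y * w else 0#)
  if-*ʳ true  y w = refl
  if-*ʳ false y w = zeroʳ y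

  if-nonneg : ∀ (t : Bool) {y} → 0# ≤ y → 0# ≤ (if t then y else 0#)
  if-nonneg true  0≤y = 0≤y
  if-nonneg false _   = inj₂ refl

  fromℕ-if : ∀ (t : Bool) n → fromℕ (if t then n else 0) ≡ (if t then fromℕ n else 0#)
  fromℕ-if true  n = refl
  fromℕ-if false n = refl

  ≤-indicator-split : ∀ k t (y : Carrier) →
    (if ⌊ k ℕ.≤? t ⌋ then y else 0#) ≡
    (if ⌊ t ℕ.≟ k ⌋ then y else 0#) + (if ⌊ suc k ℕ.≤? t ⌋ then y else 0#)
  ≤-indicator-split k t y with k ℕ.≤? t | t ℕ.≟ k | suc k ℕ.≤? t
  ... | yes _   | yes _    | no _    = sym (+-identityʳ y)
  ... | yes _   | no _     | yes _   = sym (+-identityˡ y)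
  ... | no _    | no _     | no _    = sym (+-identityˡ 0#)
  ... | yes k≤t | no t≢k   | no k≮t  = contradiction (ℕ.≤∧≢⇒< k≤t (t≢k ∘ sym)) k≮t
  ... | _       | yes refl | yes k<k = contradiction k<k (ℕ.<-irrefl refl)
  ... | no k≰k  | yes refl | _       = contradiction ℕ.≤-refl k≰k
  ... | no k≰t  | no _     | yes k<t = contradiction (ℕ.<⇒≤ k<t) k≰t

  <-indicator-split : ∀ t k (y : Carrier) →
    (if ⌊ t ℕ.<? suc k ⌋ then y else 0#) ≡
    (if ⌊ t ℕ.<? k ⌋ then y else 0#) + (if ⌊ t ℕ.≟ k ⌋ then y else 0#)
  <-indicator-split t k y with t ℕ.<? suc k | t ℕ.<? k | t ℕ.≟ k
  ... | yes _     | yes _   | no _     = sym (+-identityʳ y)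
  ... | yes _     | no _    | yes _    = sym (+-identityˡ y)
  ... | no _      | no _    | no _     = sym (+-identityˡ 0#)
  ... | yes t<1+k | no t≮k  | no t≢k   = contradiction (ℕ.≤∧≢⇒< (ℕ.s≤s⁻¹ t<1+k) t≢k) t≮k
  ... | _         | yes t<t | yes refl = contradiction t<t (ℕ.<-irrefl refl)
  ... | no t≮1+t  | _       | yes refl = contradiction (ℕ.n<1+n t) t≮1+t
  ... | no t≮1+k  | yes t<k | _        = contradiction (ℕ.m<n⇒m<1+n t<k) t≮1+k

  sumFin-indicator-≡ : ∀ n (i : Fin n) (f : Fin n → Carrier) →
    sumFin n (λ j → if ⌊ toℕ j ℕ.≟ toℕ i ⌋ then f j else 0#) ≡ f i
  sumFin-indicator-≡ n i f =
    trans (sumFin-δ n i _ off-diagonal) (cong (if_then f i else 0#) (⌊⌋-true (toℕ i ℕ.≟ toℕ i) refl))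
    where
    off-diagonal : ∀ j → j ≢ i → (if ⌊ toℕ j ℕ.≟ toℕ i ⌋ then f j else 0#) ≡ 0#
    off-diagonal j j≢i = cong (if_then f j else 0#) (⌊⌋-false (toℕ j ℕ.≟ toℕ i) (j≢i ∘ Fin.toℕ-injective))

  tailSum : (n : ℕ) → (Fin n → Carrier) → ℕ → Carrier
  tailSum n f k = sumFin n (λ i → if ⌊ k ℕ.≤? toℕ i ⌋ then f i else 0#)

  headSum : (n : ℕ) → (Fin n → Carrier) → ℕ → Carrier
  headSum n f k = sumFin n (λ i → if ⌊ toℕ i ℕ.<? k ⌋ then f i else 0#)

  tailSum-step : ∀ n f (i : Fin n) → tailSum n f (toℕ i) ≡ f i + tailSum n f (suc (toℕ i))
  tailSum-step n f i = begin
    tailSum n f (toℕ i)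
      ≡⟨ sumFin-cong n (λ j → ≤-indicator-split (toℕ i) (toℕ j) (f j)) ⟩
    sumFin n (λ j → (if ⌊ toℕ j ℕ.≟ toℕ i ⌋ then f j else 0#) +
                    (if ⌊ suc (toℕ i) ℕ.≤? toℕ j ⌋ then f j else 0#))
      ≡⟨ sumFin-+ n _ _ ⟩
    sumFin n (λ j → if ⌊ toℕ j ℕ.≟ toℕ i ⌋ then f j else 0#) + tailSum n f (suc (toℕ i))
      ≡⟨ cong (_+ tailSum n f (suc (toℕ i))) (sumFin-indicator-≡ n i f) ⟩
    f i + tailSum n f (suc (toℕ i)) ∎
    where open ≡-Reasoning

  headSum-step : ∀ n f (i : Fin n) → headSum n f (suc (toℕ i)) ≡ headSum n f (toℕ i) + f i
  headSum-step n f i = begin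
    headSum n f (suc (toℕ i))
      ≡⟨ sumFin-cong n (λ j → <-indicator-split (toℕ j) (toℕ i) (f j)) ⟩
    sumFin n (λ j → (if ⌊ toℕ j ℕ.<? toℕ i ⌋ then f j else 0#) +
                    (if ⌊ toℕ j ℕ.≟ toℕ i ⌋ then f j else 0#))
      ≡⟨ sumFin-+ n _ _ ⟩
    headSum n f (toℕ i) + sumFin n (λ j → if ⌊ toℕ j ℕ.≟ toℕ i ⌋ then f j else 0#)
      ≡⟨ cong (headSum n f (toℕ i) +_) (sumFin-indicator-≡ n i f) ⟩
    headSum n f (toℕ i) + f i ∎
    where open ≡-Reasoning

  headSum-zero : ∀ n f → headSum n f 0 ≡ 0#
  headSum-zero n f = sumFin-zero n

  tailSum-end : ∀ n f → tailSum n f n ≡ 0#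
  tailSum-end n f = trans (sumFin-cong n beyond) (sumFin-zero n)
    where
    beyond : ∀ i → (if ⌊ n ℕ.≤? toℕ i ⌋ then f i else 0#) ≡ 0#
    beyond i = cong (if_then f i else 0#) (⌊⌋-false (n ℕ.≤? toℕ i) (ℕ.<⇒≱ (Fin.toℕ<n i)))

  tailSum-last : ∀ n f → tailSum (suc n) f (toℕ (Fin.fromℕ n)) ≡ f (Fin.fromℕ n)
  tailSum-last n f = begin
    tailSum (suc n) f (toℕ last)               ≡⟨ tailSum-step (suc n) f last ⟩
    f last + tailSum (suc n) f (suc (toℕ last)) ≡⟨ cong (λ k → f last + tailSum (suc n) f (suc k)) (Fin.toℕ-fromℕ n) ⟩
    f last + tailSum (suc n) f (suc n)          ≡⟨ cong (f last +_) (tailSum-end (suc n) f) ⟩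
    f last + 0#                                 ≡⟨ +-identityʳ _ ⟩
    f last                                      ∎
    where
    open ≡-Reasoning
    last = Fin.fromℕ n

  tailSum-step-inject₁ : ∀ n f (i : Fin n) →
    tailSum (suc n) f (toℕ (inject₁ i)) ≡ f (inject₁ i) + tailSum (suc n) f (suc (toℕ i))
  tailSum-step-inject₁ n f i = trans (tailSum-step (suc n) f (inject₁ i))
    (cong (λ k → f (inject₁ i) + tailSum (suc n) f (suc k)) (Fin.toℕ-inject₁ i))

  tailSum-neg : ∀ n f k → tailSum n (λ i → - f i) k ≡ - tailSum n f k
  tailSum-neg n f k = trans (sumFin-cong n (λ i → if-neg ⌊ k ℕ.≤? toℕ i ⌋ (f i))) (sumFin-neg n _)
    where
    if-neg : ∀ (t : Bool) y → (if t then - y else 0#) ≡ - (if t then y else 0#)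
    if-neg true  y = refl
    if-neg false y = sym -0#≈0#

  tailSum-nonneg : ∀ n f → (∀ i → 0# ≤ f i) → ∀ k → 0# ≤ tailSum n f k
  tailSum-nonneg n f 0≤f k = sumFin-nonneg n _ (λ i → if-nonneg ⌊ k ℕ.≤? toℕ i ⌋ (0≤f i))

  tailSum-pos : ∀ n f → (∀ i → 0# < f i) → ∀ i → 0# < tailSum n f (toℕ i)
  tailSum-pos n f 0<f i = subst (0# <_) (sym (tailSum-step n f i))
    (+-pos-nonneg (0<f i) (tailSum-nonneg n f (inj₁ ∘ 0<f) _))

  tailSum-antitone : ∀ n f → (∀ i → 0# ≤ f i) → ∀ {j k} → j ≤ℕ k → tailSum n f k ≤ tailSum n f j
  tailSum-antitone n f 0≤f {j} {k} j≤k =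
    sumFin-mono n _ _ (λ i → pointwise (k ℕ.≤? toℕ i) (j ℕ.≤? toℕ i) (0≤f i))
    where
    pointwise : ∀ {t y} (k? : Dec (k ≤ℕ t)) (j? : Dec (j ≤ℕ t)) → 0# ≤ y →
                (if ⌊ k? ⌋ then y else 0#) ≤ (if ⌊ j? ⌋ then y else 0#)
    pointwise (yes _)   (yes _)   _   = inj₂ refl
    pointwise (yes k≤t) (no j≰t)  _   = contradiction (ℕ.≤-trans j≤k k≤t) j≰t
    pointwise (no _)    (yes _)   0≤y = 0≤y
    pointwise (no _)    (no _)    _   = inj₂ refl

sameIso-≢ : ∀ {m} (is : Fin m → ℕ) {q q′} (j : Fin (is q)) (j′ : Fin (is q′)) →
            q′ ≢ q → sameIso m is (q , j) (q′ , j′) ≡ false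
sameIso-≢ is {q} {q′} j j′ q′≢q with q Fin.≟ q′
... | yes refl = contradiction refl q′≢q
... | no _     = refl

sameIso-diagonal : ∀ {m} (is : Fin m → ℕ) {q} (j j′ : Fin (is q)) →
                   sameIso m is (q , j) (q , j′) ≡ ⌊ j Fin.≟ j′ ⌋
sameIso-diagonal is {q} j j′ with q Fin.≟ q
... | yes refl = refl
... | no q≢q   = contradiction refl q≢q

module _ (R : Reals) where
  open Reals R
  open OrderedField R
  open FiniteSums R

  toℕ-minFin : ∀ {n} (p p′ : Fin n) → toℕ (minFin R p p′) ≡ toℕ p ℕ.⊓ toℕ p′
  toℕ-minFin p p′ = by-cases (toℕ p ℕ.≤? toℕ p′)
    where
    by-cases : (p≤?p′ : Dec (toℕ p ≤ℕ toℕ p′)) →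
               toℕ (if ⌊ p≤?p′ ⌋ then p else p′) ≡ toℕ p ℕ.⊓ toℕ p′
    by-cases (yes p≤p′) = sym (ℕ.m≤n⇒m⊓n≡m p≤p′)
    by-cases (no p≰p′)  = sym (ℕ.m≥n⇒m⊓n≡n (ℕ.≰⇒≥ p≰p′))

  module ReducedEquations {m : ℕ}
      (K : Fin (suc m) → Carrier) (I b : Fin m → Carrier)
      (K-pos : ∀ p → 0# < K p) (I-pos : ∀ q → 0# < I q)
      (b-def : ∀ q → b q ≡ tailSum (suc m) K (suc (toℕ q)) ⁻¹) where

    k : Carrier
    k = sumFin (suc m) K

    i : Carrier
    i = sumFin m I

    B : ℕ → Carrier
    B = tailSum (suc m) K

    T : (Fin (suc m) → Carrier) → ℕ → Carrier
    T c = tailSum (suc m) (λ p → K p * c p)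

    B-pos : ∀ p → 0# < B (toℕ p)
    B-pos = tailSum-pos (suc m) K K-pos

    b-pos : ∀ q → 0# < b q
    b-pos q = subst (0# <_) (sym (b-def q)) (⁻¹-pos (B-pos (suc q)))

    b*B≡1 : ∀ q → b q * B (suc (toℕ q)) ≡ 1#
    b*B≡1 q = trans (cong (_* B (suc (toℕ q))) (b-def q))
      (trans (*-comm _ _) (⁻¹-inverse _ (0<x⇒x≢0 (B-pos (suc q)))))

    b-monotone : ∀ {q q′} → toℕ q ≤ℕ toℕ q′ → b q ≤ b q′
    b-monotone {q} {q′} q≤q′ = subst₂ _≤_ (sym (b-def q)) (sym (b-def q′))
      (⁻¹-antitone-≤ (B-pos (suc q′)) (tailSum-antitone (suc m) K (inj₁ ∘ K-pos) (ℕ.s≤s q≤q′)))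

    k⁻¹<b : ∀ q → k ⁻¹ < b q
    k⁻¹<b q = subst (k ⁻¹ <_) (sym (b-def q)) (⁻¹-antitone (B-pos (suc q)) B<k)
      where
      B<k : B (suc (toℕ q)) < k
      B<k = begin-strict
        B (suc (toℕ q)) ≤⟨ tailSum-antitone (suc m) K (inj₁ ∘ K-pos) (ℕ.s≤s ℕ.z≤n) ⟩
        B 1             <⟨ subst (_< K zero + B 1) (+-identityˡ (B 1)) (+-mono-< (B 1) (K-pos zero)) ⟩
        K zero + B 1    ≡⟨ tailSum-step (suc m) K zero ⟨
        k               ∎
        where open StrictReasoning strictPartialOrder

    T-step-inject₁ : ∀ c q → T c (toℕ (inject₁ q)) ≡ K (inject₁ q) * c (inject₁ q) + T c (suc (toℕ q))
    T-step-inject₁ c = tailSum-step-inject₁ m (λ p → K p * c p)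

    T-neg : ∀ c n → T (λ p → - c p) n ≡ - T c n
    T-neg c n = trans (sumFin-cong (suc m) negate-term) (tailSum-neg (suc m) (λ p → K p * c p) n)
      where
      negate-term : ∀ p → (if ⌊ n ℕ.≤? toℕ p ⌋ then K p * - c p else 0#) ≡
                          (if ⌊ n ℕ.≤? toℕ p ⌋ then - (K p * c p) else 0#)
      negate-term p = cong (if ⌊ n ℕ.≤? toℕ p ⌋ then_else 0#) (sym (-‿distribʳ-* (K p) (c p)))

    T-vanishes : ∀ c → (∀ p → c p ≡ 0#) → ∀ n → T c n ≡ 0#
    T-vanishes c c≡0 n =
      trans (sumFin-cong (suc m) (λ p → cong (λ y → if ⌊ n ℕ.≤? toℕ p ⌋ then K p * y else 0#) (c≡0 p)))
        (trans (sumFin-cong (suc m) (λ p → vanish ⌊ n ℕ.≤? toℕ p ⌋ (zeroʳ (K p)))) (sumFin-zero (suc m)))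
      where
      vanish : ∀ (t : Bool) {y} → y ≡ 0# → (if t then y else 0#) ≡ 0#
      vanish true  y≡0 = y≡0
      vanish false _   = refl

    T-last : ∀ c → T c (toℕ (Fin.fromℕ m)) ≡ K (Fin.fromℕ m) * c (Fin.fromℕ m)
    T-last c = tailSum-last m (λ p → K p * c p)

    T-pos : ∀ {c} → (∀ p → 0# < c p) → ∀ p → 0# < T c (toℕ p)
    T-pos 0<c = tailSum-pos (suc m) _ (λ p → *-pos (K-pos p) (0<c p))

    -- c p is the value of an eigenvector on cone block p, Z q its sum over isolate block q.
    record Solution (α λ′ : Carrier) (c : Fin (suc m) → Carrier) (Z : Fin m → Carrier) : Set where
      field
        first-row : λ′ * c zero ≡ - (α * T c 0)
        step      : ∀ q → c (suc q) ≡ c (inject₁ q) - Z q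
        isolate   : ∀ q → Z q * (b q - λ′) ≡ I q * (b q * T c (suc (toℕ q)))

    record PositiveSolution (α λ′ : Carrier) : Set where
      field
        c        : Fin (suc m) → Carrier
        Z        : Fin m → Carrier
        solution : Solution α λ′ c Z
        c-pos    : ∀ p → 0# < c p

    Solution-neg : ∀ {α λ′ c Z} → Solution α λ′ c Z → Solution α λ′ (λ p → - c p) (λ q → - Z q)
    Solution-neg {α} {λ′} {c} {Z} s = record
      { first-row = begin
          λ′ * - c zero            ≡⟨ -‿distribʳ-* λ′ (c zero) ⟨
          - (λ′ * c zero)          ≡⟨ cong -_ first-row ⟩
          - - (α * T c 0)          ≡⟨ cong -_ (-‿distribʳ-* α (T c 0)) ⟩
          - (α * - T c 0)          ≡⟨ cong (λ t → - (α * t)) (T-neg c 0) ⟨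
          - (α * T (λ p → - c p) 0) ∎
      ; step = λ q → trans (cong -_ (step q))
          (solve 2 (λ x z → :- (x :- z) := (:- x) :- (:- z)) refl (c (inject₁ q)) (Z q))
      ; isolate = λ q → begin
          - Z q * (b q - λ′)                        ≡⟨ -‿distribˡ-* (Z q) _ ⟨
          - (Z q * (b q - λ′))                      ≡⟨ cong -_ (isolate q) ⟩
          - (I q * (b q * T c (suc (toℕ q))))
            ≡⟨ solve 3 (λ i b t → :- (i :* (b :* t)) := i :* (b :* (:- t))) refl (I q) (b q) _ ⟩
          I q * (b q * - T c (suc (toℕ q)))         ≡⟨ cong (λ t → I q * (b q * t)) (T-neg c _) ⟨
          I q * (b q * T (λ p → - c p) (suc (toℕ q))) ∎
      }
      where
      open Solution s
      open ≡-Reasoning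

    module Propagation {α λ′ c Z} (s : Solution α λ′ c Z) (λ<b : ∀ q → λ′ < b q) where
      open Solution s

      gap-pos : ∀ q → 0# < b q - λ′
      gap-pos q = x<y⇒0<y-x (λ<b q)

      Z-pos : ∀ q → 0# < T c (suc (toℕ q)) → 0# < Z q
      Z-pos q 0<T = *-pos-cancelˡ (gap-pos q)
        (subst (0# <_) (trans (sym (isolate q)) (*-comm _ _)) (*-pos (I-pos q) (*-pos (b-pos q) 0<T)))

      Z-vanishes : ∀ q → T c (suc (toℕ q)) ≡ 0# → Z q ≡ 0#
      Z-vanishes q T≡0 = *-cancelˡ (0<x⇒x≢0 (gap-pos q)) (begin
        (b q - λ′) * Z q                      ≡⟨ *-comm _ _ ⟩
        Z q * (b q - λ′)                      ≡⟨ isolate q ⟩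
        I q * (b q * T c (suc (toℕ q)))       ≡⟨ cong (λ t → I q * (b q * t)) T≡0 ⟩
        I q * (b q * 0#)                      ≡⟨ trans (cong (I q *_) (zeroʳ _)) (zeroʳ _) ⟩
        0#                                    ≡⟨ zeroʳ _ ⟨
        (b q - λ′) * 0#                       ∎)
        where open ≡-Reasoning

      c-inject₁ : ∀ q → c (inject₁ q) ≡ c (suc q) + Z q
      c-inject₁ q = sym (trans (cong (_+ Z q) (step q)) (solve 2 (λ x z → (x :- z) :+ z := x) refl _ _))

      positive-from-last : 0# < c (Fin.fromℕ m) → ∀ p → 0# < c p
      positive-from-last 0<cₘ = proj₁ ∘ >-weakInduction P base downward
        where
        P : Fin (suc m) → Set
        P p = 0# < c p × 0# < T c (toℕ p)
        base : P (Fin.fromℕ m)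
        base = 0<cₘ , subst (0# <_) (sym (T-last c)) (*-pos (K-pos _) 0<cₘ)
        downward : ∀ q → P (suc q) → P (inject₁ q)
        downward q (0<c , 0<T) = 0<c′ , subst (0# <_) (sym (T-step-inject₁ c q)) (+-pos (*-pos (K-pos _) 0<c′) 0<T)
          where
          0<c′ : 0# < c (inject₁ q)
          0<c′ = subst (0# <_) (sym (c-inject₁ q)) (+-pos 0<c (Z-pos q 0<T))

      zero-from-last : c (Fin.fromℕ m) ≡ 0# → ∀ p → c p ≡ 0#
      zero-from-last cₘ≡0 = proj₁ ∘ >-weakInduction P base downward
        where
        P : Fin (suc m) → Set
        P p = c p ≡ 0# × T c (toℕ p) ≡ 0#
        base : P (Fin.fromℕ m)
        base = cₘ≡0 , trans (T-last c) (trans (cong (K _ *_) cₘ≡0) (zeroʳ _))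
        downward : ∀ q → P (suc q) → P (inject₁ q)
        downward q (c≡0 , T≡0) = c′≡0 , trans (T-step-inject₁ c q)
            (trans (cong₂ (λ x t → K (inject₁ q) * x + t) c′≡0 T≡0) (trans (+-identityʳ _) (zeroʳ _)))
          where
          c′≡0 : c (inject₁ q) ≡ 0#
          c′≡0 = trans (c-inject₁ q) (trans (cong₂ _+_ c≡0 (Z-vanishes q T≡0)) (+-identityʳ 0#))

    positive-solution : ∀ {α λ′ c Z} → Solution α λ′ c Z → (∀ q → λ′ < b q) → ¬ (∀ p → c p ≡ 0#) →
                        PositiveSolution α λ′
    positive-solution {c = c} s λ<b c≢0 with compare 0# (c (Fin.fromℕ m))
    ... | tri< 0<cₘ _ _ = record { solution = s ; c-pos = Propagation.positive-from-last s λ<b 0<cₘ }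
    ... | tri≈ _ 0≡cₘ _ = contradiction (Propagation.zero-from-last s λ<b (sym 0≡cₘ)) c≢0
    ... | tri> _ _ cₘ<0 = record
      { solution = Solution-neg s ; c-pos = Propagation.positive-from-last (Solution-neg s) λ<b (x<0⇒0<-x cₘ<0) }

    positive-eigenvalue-absurd : ∀ {α λ′} → 0# < α → 0# < λ′ → ¬ PositiveSolution α λ′
    positive-eigenvalue-absurd 0<α 0<λ′ ps =
      asym (0<x⇒-x<0 (*-pos 0<α (T-pos c-pos zero))) (subst (0# <_) first-row (*-pos 0<λ′ (c-pos zero)))
      where
      open PositiveSolution ps
      open Solution solution

    module SummedEquations {α λ′ c Z} (s : Solution α λ′ c Z) where
      open Solution s

      G : Fin (suc m) → Carrier
      G p = T c (toℕ p) - (B (toℕ p) * c p)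

      G-step : ∀ q → G (suc q) - G (inject₁ q) ≡ B (suc (toℕ q)) * Z q
      G-step q = begin
        G (suc q) - G (inject₁ q)
          ≡⟨ cong₂ (λ x y → (T₁ - (B₁ * x)) - y) (step q)
                   (cong₂ (λ t β → t - (β * cᵢ)) (T-step-inject₁ c q) (tailSum-step-inject₁ m K q)) ⟩
        (T₁ - (B₁ * (cᵢ - Z q))) - ((Kᵢ * cᵢ + T₁) - ((Kᵢ + B₁) * cᵢ))
          ≡⟨ solve 5 (λ t β x z κ → (t :- (β :* (x :- z))) :- ((κ :* x :+ t) :- ((κ :+ β) :* x)) := β :* z)
                     refl T₁ B₁ cᵢ (Z q) Kᵢ ⟩
        B₁ * Z q ∎
        where
        open ≡-Reasoning
        T₁ = T c (suc (toℕ q))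
        B₁ = B (suc (toℕ q))
        Kᵢ = K (inject₁ q)
        cᵢ = c (inject₁ q)

      G-last : G (Fin.fromℕ m) ≡ 0#
      G-last = trans (cong₂ (λ t β → t - (β * c (Fin.fromℕ m))) (T-last c) (tailSum-last m K)) (-‿inverseʳ _)

      weighted-Z-sum : sumFin m (λ q → B (suc (toℕ q)) * Z q) ≡ (k * c zero) - T c 0
      weighted-Z-sum = begin
        sumFin m (λ q → B (suc (toℕ q)) * Z q)   ≡⟨ sumFin-cong m (sym ∘ G-step) ⟩
        sumFin m (λ q → G (suc q) - G (inject₁ q)) ≡⟨ sumFin-telescope m G ⟩
        G (Fin.fromℕ m) - G zero                  ≡⟨ cong (_- G zero) G-last ⟩
        0# - (T c 0 - (k * c zero))               ≡⟨ trans (+-identityˡ _) (⁻¹-anti-homo‿- _ _) ⟩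
        (k * c zero) - T c 0                      ∎
        where open ≡-Reasoning

      λ-weighted-Z : ∀ q → λ′ * (B (suc (toℕ q)) * Z q) ≡ Z q - (I q * T c (suc (toℕ q)))
      λ-weighted-Z q = begin
        λ′ * (B₁ * Z q)
          ≡⟨ solve 4 (λ l β z b → l :* (β :* z) := ((b :* β) :* z) :- ((z :* (b :- l)) :* β))
                     refl λ′ B₁ (Z q) (b q) ⟩
        ((b q * B₁) * Z q) - ((Z q * (b q - λ′)) * B₁)
          ≡⟨ cong (λ t → ((b q * B₁) * Z q) - (t * B₁)) (isolate q) ⟩
        ((b q * B₁) * Z q) - ((I q * (b q * T₁)) * B₁)
          ≡⟨ solve 5 (λ β ι z i t → ((β :* ι) :* z) :- ((i :* (β :* t)) :* ι)
                                  := ((β :* ι) :* z) :- ((i :* t) :* (β :* ι)))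
                     refl (b q) B₁ (Z q) (I q) T₁ ⟩
        ((b q * B₁) * Z q) - ((I q * T₁) * (b q * B₁))
          ≡⟨ cong (λ u → (u * Z q) - ((I q * T₁) * u)) (b*B≡1 q) ⟩
        (1# * Z q) - ((I q * T₁) * 1#)
          ≡⟨ cong₂ _-_ (*-identityˡ _) (*-identityʳ _) ⟩
        Z q - (I q * T₁) ∎
        where
        open ≡-Reasoning
        T₁ = T c (suc (toℕ q))
        B₁ = B (suc (toℕ q))

      excess : Fin m → Carrier
      excess q = Z q + I q * (T c 0 - T c (suc (toℕ q)))

      excess-sum : sumFin m excess ≡ λ′ * ((k * c zero) - T c 0) + i * T c 0
      excess-sum = begin
        sumFin m excess
          ≡⟨ sumFin-cong m (λ q → solve 4 (λ z ι t₀ t₁ → z :+ ι :* (t₀ :- t₁) := (z :- (ι :* t₁)) :+ t₀ :* ι)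
                                            refl (Z q) (I q) (T c 0) (T c (suc (toℕ q)))) ⟩
        sumFin m (λ q → (Z q - (I q * T c (suc (toℕ q)))) + T c 0 * I q)
          ≡⟨ sumFin-+ m _ _ ⟩
        sumFin m (λ q → Z q - (I q * T c (suc (toℕ q)))) + sumFin m (λ q → T c 0 * I q)
          ≡⟨ cong₂ _+_ (sumFin-cong m (sym ∘ λ-weighted-Z)) (sumFin-*ˡ m (T c 0) I) ⟩
        sumFin m (λ q → λ′ * (B (suc (toℕ q)) * Z q)) + T c 0 * i
          ≡⟨ cong₂ _+_ (sumFin-*ˡ m λ′ _) (*-comm _ _) ⟩
        λ′ * sumFin m (λ q → B (suc (toℕ q)) * Z q) + i * T c 0
          ≡⟨ cong (λ t → λ′ * t + i * T c 0) weighted-Z-sum ⟩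
        λ′ * ((k * c zero) - T c 0) + i * T c 0 ∎
        where open ≡-Reasoning

      summed-identity : ((λ′ + k * α) - i) * T c 0 ≡ - sumFin m excess
      summed-identity = begin
        ((λ′ + k * α) - i) * T c 0
          ≡⟨ solve 6 (λ l κ a ι t x → ((l :+ κ :* a) :- ι) :* t
                                     := (:- (l :* ((κ :* x) :- t) :+ ι :* t)) :+ κ :* (l :* x :+ a :* t))
                     refl λ′ k α i (T c 0) (c zero) ⟩
        - E + k * (λ′ * c zero + α * T c 0)
          ≡⟨ cong (λ u → - E + k * (u + α * T c 0)) first-row ⟩
        - E + k * (- (α * T c 0) + α * T c 0)
          ≡⟨ cong (λ u → - E + k * u) (-‿inverseˡ _) ⟩
        - E + k * 0#
          ≡⟨ trans (cong (- E +_) (zeroʳ k)) (+-identityʳ _) ⟩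
        - E
          ≡⟨ cong -_ excess-sum ⟨
        - sumFin m excess ∎
        where
        open ≡-Reasoning
        E = λ′ * ((k * c zero) - T c 0) + i * T c 0

    negative-eigenvalue-bound : ∀ {α λ′} → 1 ≤ℕ m → (∀ q → λ′ < b q) → PositiveSolution α λ′ →
                                λ′ < - (k * α) + i
    negative-eigenvalue-bound {α} {λ′} 1≤m λ<b ps = 0<y-x⇒x<y (subst (0# <_)
      (solve 4 (λ l κ a ι → :- ((l :+ κ :* a) :- ι) := ((:- (κ :* a)) :+ ι) :- l) refl λ′ k α i) (x<0⇒0<-x L<0))
      where
      open PositiveSolution ps
      open SummedEquations solution
      open Propagation solution λ<b using (Z-pos)
      0<excess : ∀ q → 0# < excess q
      0<excess q = +-pos-nonneg (Z-pos q (T-pos c-pos (suc q))) (*-nonneg (inj₁ (I-pos q))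
        (x≤y⇒0≤y-x (tailSum-antitone (suc m) _ (λ p → inj₁ (*-pos (K-pos p) (c-pos p))) ℕ.z≤n)))
      L<0 : (λ′ + k * α) - i < 0#
      L<0 = *-neg-cancelʳ (T-pos c-pos zero)
        (subst (_< 0#) (sym summed-identity) (0<x⇒-x<0 (sumFin-pos 1≤m excess 0<excess)))

  module ThresholdBlocks {m : ℕ} (ks : Fin (suc m) → ℕ) (is : Fin m → ℕ)
      (ks-pos : ∀ p → 1 ≤ℕ ks p) (is-pos : ∀ q → 1 ≤ℕ is q) where

    K : Fin (suc m) → Carrier
    K = fromℕ ∘ ks

    I : Fin m → Carrier
    I = fromℕ ∘ is

    b′ : Fin m → Carrier
    b′ = b R m ks

    I-pos : ∀ q → 0# < I q
    I-pos = 0<fromℕ ∘ is-pos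

    β≡tailSum : ∀ q → fromℕ (β m ks q) ≡ tailSum (suc m) K (suc (toℕ q))
    β≡tailSum q = trans (fromℕ-sumℕ (suc m) (λ p → if ⌊ toℕ q ℕ.<? toℕ p ⌋ then ks p else 0))
      (sumFin-cong (suc m) (λ p → fromℕ-if ⌊ toℕ q ℕ.<? toℕ p ⌋ (ks p)))

    open ReducedEquations K I b′ (0<fromℕ ∘ ks-pos) I-pos (cong _⁻¹ ∘ β≡tailSum) public

    kTot≡k : fromℕ (kTot m ks) ≡ k
    kTot≡k = fromℕ-sumℕ (suc m) ks

    iTot≡i : fromℕ (iTot m is) ≡ i
    iTot≡i = fromℕ-sumℕ m is

    a-pos : ∀ {α₁} → 0# < α₁ → 0# < a R m ks is α₁ zero
    a-pos 0<α₁ = +-pos-nonneg 0<α₁ (tailSum-nonneg m _ (λ s → inj₁ (*-pos (I-pos s) (b-pos s))) 0)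

    module Eigenvector (α₁ λ′ : Carrier) (λ′≢0 : λ′ ≢ 0#) (v : Vertex m ks is → Carrier)
        (eigen : ∀ u → sumV R m ks is (λ w → M R m ks is α₁ u w * v w) ≡ λ′ * v u) where

      x : (p : Fin (suc m)) → Fin (ks p) → Carrier
      x p j = v (inj₁ (p , j))

      z : (q : Fin m) → Fin (is q) → Carrier
      z q j = v (inj₂ (q , j))

      X : Fin (suc m) → Carrier
      X p = sumFin (ks p) (x p)

      Z : Fin m → Carrier
      Z q = sumFin (is q) (z q)

      a′ : Fin (suc m) → Carrier
      a′ = a R m ks is α₁

      -- a′ p unfolds to A (toℕ p).
      A : ℕ → Carrier
      A n = α₁ + tailSum m (λ s → I s * b′ s) n

      coneIsolate : Fin (suc m) → Fin m → Carrier
      coneIsolate p q = if ⌊ toℕ q ℕ.<? toℕ p ⌋ then - b′ q else 0#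

      isolateIsolate : (u w : Σ (Fin m) (λ q → Fin (is q))) → Carrier
      isolateIsolate u w = if sameIso m is u w then b′ (proj₁ u) else 0#

      conePart : Fin (suc m) → Carrier
      conePart p = sumFin (suc m) (λ p′ → - a′ (minFin R p p′) * X p′)

      isolatePart : Fin (suc m) → Carrier
      isolatePart p = headSum m (λ q → - b′ q * Z q) (toℕ p)

      coneRow : Fin (suc m) → Carrier
      coneRow p = conePart p + isolatePart p

      cone-equation : ∀ p j → coneRow p ≡ λ′ * x p j
      cone-equation p j = trans (cong₂ _+_ cones isolates) (eigen (inj₁ (p , j)))
        where
        cones : conePart p ≡ sumFin (suc m) (λ p′ → sumFin (ks p′) (λ j′ → - a′ (minFin R p p′) * x p′ j′))
        cones = sumFin-cong (suc m) (λ p′ → sym (sumFin-*ˡ (ks p′) (- a′ (minFin R p p′)) (x p′)))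
        isolates : isolatePart p ≡ sumFin m (λ q → sumFin (is q) (λ j′ → coneIsolate p q * z q j′))
        isolates = sumFin-cong m (λ q →
          trans (sym (if-*ˡ ⌊ toℕ q ℕ.<? toℕ p ⌋ (- b′ q) (Z q))) (sym (sumFin-*ˡ (is q) (coneIsolate p q) (z q))))

      c : Fin (suc m) → Carrier
      c p = λ′ ⁻¹ * coneRow p

      λ′c≡coneRow : ∀ p → λ′ * c p ≡ coneRow p
      λ′c≡coneRow p =
        trans (sym (*-assoc _ _ _)) (trans (cong (_* coneRow p) (⁻¹-inverse λ′ λ′≢0)) (*-identityˡ _))

      x≡c : ∀ p j → x p j ≡ c p
      x≡c p j = *-cancelˡ λ′≢0 (trans (sym (cone-equation p j)) (sym (λ′c≡coneRow p)))

      T≡tailSum-X : ∀ n → T c n ≡ tailSum (suc m) X n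
      T≡tailSum-X n = sumFin-cong (suc m) (λ p → cong (if ⌊ n ℕ.≤? toℕ p ⌋ then_else 0#) (sym (X≡Kc p)))
        where
        X≡Kc : ∀ p → X p ≡ K p * c p
        X≡Kc p = trans (sumFin-cong (ks p) (x≡c p)) (sumFin-const (ks p) (c p))

      cone-contribution : ∀ q → sumFin (suc m) (λ p → sumFin (ks p) (λ j′ → coneIsolate p q * x p j′)) ≡
                                - b′ q * T c (suc (toℕ q))
      cone-contribution q = begin
        sumFin (suc m) (λ p → sumFin (ks p) (λ j′ → coneIsolate p q * x p j′))
          ≡⟨ sumFin-cong (suc m) (λ p → sumFin-*ˡ (ks p) (coneIsolate p q) (x p)) ⟩
        sumFin (suc m) (λ p → coneIsolate p q * X p)
          ≡⟨ sumFin-cong (suc m) (λ p → trans (if-*ˡ (t p) (- b′ q) (X p)) (sym (if-*ʳ (t p) (- b′ q) (X p)))) ⟩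
        sumFin (suc m) (λ p → - b′ q * (if t p then X p else 0#))
          ≡⟨ sumFin-*ˡ (suc m) (- b′ q) (λ p → if t p then X p else 0#) ⟩
        - b′ q * tailSum (suc m) X (suc (toℕ q))
          ≡⟨ cong (- b′ q *_) (T≡tailSum-X _) ⟨
        - b′ q * T c (suc (toℕ q)) ∎
        where
        open ≡-Reasoning
        t : Fin (suc m) → Bool
        t p = ⌊ toℕ q ℕ.<? toℕ p ⌋

      isolate-contribution : ∀ q j →
        sumFin m (λ q′ → sumFin (is q′) (λ j′ → isolateIsolate (q , j) (q′ , j′) * z q′ j′)) ≡ b′ q * z q j
      isolate-contribution q j = begin
        sumFin m (λ q′ → sumFin (is q′) (λ j′ → isolateIsolate (q , j) (q′ , j′) * z q′ j′))
          ≡⟨ sumFin-δ m q _ other-blocks ⟩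
        sumFin (is q) (λ j′ → isolateIsolate (q , j) (q , j′) * z q j′)
          ≡⟨ sumFin-δ (is q) j _ other-vertices ⟩
        isolateIsolate (q , j) (q , j) * z q j
          ≡⟨ trans (term q j) (cong (if_then b′ q * z q j else 0#)
                                    (trans (sameIso-diagonal is j j) (⌊⌋-true (j Fin.≟ j) refl))) ⟩
        b′ q * z q j ∎
        where
        open ≡-Reasoning
        term : ∀ q′ j′ → isolateIsolate (q , j) (q′ , j′) * z q′ j′ ≡
                         (if sameIso m is (q , j) (q′ , j′) then b′ q * z q′ j′ else 0#)
        term q′ j′ = if-*ˡ (sameIso m is (q , j) (q′ , j′)) (b′ q) (z q′ j′)
        other-blocks : ∀ q′ → q′ ≢ q → sumFin (is q′) (λ j′ → isolateIsolate (q , j) (q′ , j′) * z q′ j′) ≡ 0#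
        other-blocks q′ q′≢q = trans (sumFin-cong (is q′) off) (sumFin-zero (is q′))
          where
          off : ∀ j′ → isolateIsolate (q , j) (q′ , j′) * z q′ j′ ≡ 0#
          off j′ = trans (term q′ j′) (cong (if_then b′ q * z q′ j′ else 0#) (sameIso-≢ is j j′ q′≢q))
        other-vertices : ∀ j′ → j′ ≢ j → isolateIsolate (q , j) (q , j′) * z q j′ ≡ 0#
        other-vertices j′ j′≢j = trans (term q j′) (cong (if_then b′ q * z q j′ else 0#)
          (trans (sameIso-diagonal is j j′) (⌊⌋-false (j Fin.≟ j′) (j′≢j ∘ sym))))

      isolate-equation : ∀ q j → - b′ q * T c (suc (toℕ q)) + b′ q * z q j ≡ λ′ * z q j
      isolate-equation q j =
        trans (cong₂ _+_ (sym (cone-contribution q)) (sym (isolate-contribution q j))) (eigen (inj₂ (q , j)))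

      isolate-vertex : ∀ q j → z q j * (b′ q - λ′) ≡ b′ q * T c (suc (toℕ q))
      isolate-vertex q j = begin
        z q j * (b′ q - λ′)
          ≡⟨ solve 4 (λ ζ β t l → ζ :* (β :- l) := β :* t :+ (((:- β) :* t :+ β :* ζ) :- l :* ζ))
                     refl (z q j) (b′ q) T₁ λ′ ⟩
        b′ q * T₁ + ((- b′ q * T₁ + b′ q * z q j) - (λ′ * z q j))
          ≡⟨ cong (λ u → b′ q * T₁ + (u - (λ′ * z q j))) (isolate-equation q j) ⟩
        b′ q * T₁ + ((λ′ * z q j) - (λ′ * z q j))
          ≡⟨ trans (cong (b′ q * T₁ +_) (-‿inverseʳ _)) (+-identityʳ _) ⟩
        b′ q * T₁ ∎
        where
        open ≡-Reasoning
        T₁ = T c (suc (toℕ q))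

      isolate-block : ∀ q → Z q * (b′ q - λ′) ≡ I q * (b′ q * T c (suc (toℕ q)))
      isolate-block q = begin
        Z q * (b′ q - λ′)
          ≡⟨ *-comm _ _ ⟩
        (b′ q - λ′) * Z q
          ≡⟨ sumFin-*ˡ (is q) (b′ q - λ′) (z q) ⟨
        sumFin (is q) (λ j → (b′ q - λ′) * z q j)
          ≡⟨ sumFin-cong (is q) (λ j → trans (*-comm _ _) (isolate-vertex q j)) ⟩
        sumFin (is q) (λ _ → b′ q * T c (suc (toℕ q)))
          ≡⟨ sumFin-const (is q) _ ⟩
        I q * (b′ q * T c (suc (toℕ q))) ∎
        where open ≡-Reasoning

      A-⊓-step : ∀ q n → A (toℕ q ℕ.⊓ n) ≡
                         A (suc (toℕ q) ℕ.⊓ n) + (if ⌊ suc (toℕ q) ℕ.≤? n ⌋ then I q * b′ q else 0#)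
      A-⊓-step q n with suc (toℕ q) ℕ.≤? n
      ... | yes q<n rewrite ℕ.m≤n⇒m⊓n≡m (ℕ.<⇒≤ q<n) | ℕ.m≤n⇒m⊓n≡m q<n =
        trans (cong (α₁ +_) (tailSum-step m _ q)) (solve 3 (λ a y t → a :+ (y :+ t) := (a :+ t) :+ y) refl α₁ _ _)
      ... | no q≮n rewrite ℕ.m≥n⇒m⊓n≡n (ℕ.s≤s⁻¹ (ℕ.≰⇒> q≮n)) | ℕ.m≥n⇒m⊓n≡n (ℕ.<⇒≤ (ℕ.≰⇒> q≮n))
        = sym (+-identityʳ _)

      a-min-step : ∀ q p′ → a′ (minFin R (inject₁ q) p′) ≡
                   a′ (minFin R (suc q) p′) + (if ⌊ suc (toℕ q) ℕ.≤? toℕ p′ ⌋ then I q * b′ q else 0#)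
      a-min-step q p′ = begin
        A (toℕ (minFin R (inject₁ q) p′))  ≡⟨ cong A (toℕ-minFin (inject₁ q) p′) ⟩
        A (toℕ (inject₁ q) ℕ.⊓ toℕ p′)     ≡⟨ cong (λ t → A (t ℕ.⊓ toℕ p′)) (Fin.toℕ-inject₁ q) ⟩
        A (toℕ q ℕ.⊓ toℕ p′)               ≡⟨ A-⊓-step q (toℕ p′) ⟩
        A (suc (toℕ q) ℕ.⊓ toℕ p′) + δ     ≡⟨ cong (λ t → A t + δ) (toℕ-minFin (suc q) p′) ⟨
        A (toℕ (minFin R (suc q) p′)) + δ  ∎
        where
        open ≡-Reasoning
        δ = if ⌊ suc (toℕ q) ℕ.≤? toℕ p′ ⌋ then I q * b′ q else 0#

      conePart-step : ∀ q → conePart (suc q) ≡ conePart (inject₁ q) + (I q * b′ q) * T c (suc (toℕ q))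
      conePart-step q = begin
        conePart (suc q)
          ≡⟨ sumFin-cong (suc m) pointwise ⟩
        sumFin (suc m) (λ p′ → - a′ (minFin R (inject₁ q) p′) * X p′ + (I q * b′ q) * X≥ p′)
          ≡⟨ sumFin-+ (suc m) (λ p′ → - a′ (minFin R (inject₁ q) p′) * X p′) (((I q * b′ q) *_) ∘ X≥) ⟩
        conePart (inject₁ q) + sumFin (suc m) (λ p′ → (I q * b′ q) * X≥ p′)
          ≡⟨ cong (conePart (inject₁ q) +_) (sumFin-*ˡ (suc m) (I q * b′ q) X≥) ⟩
        conePart (inject₁ q) + (I q * b′ q) * tailSum (suc m) X (suc (toℕ q))
          ≡⟨ cong (λ t → conePart (inject₁ q) + (I q * b′ q) * t) (T≡tailSum-X _) ⟨
        conePart (inject₁ q) + (I q * b′ q) * T c (suc (toℕ q)) ∎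
        where
        open ≡-Reasoning
        X≥ : Fin (suc m) → Carrier
        X≥ p′ = if ⌊ suc (toℕ q) ℕ.≤? toℕ p′ ⌋ then X p′ else 0#
        pointwise : ∀ p′ → - a′ (minFin R (suc q) p′) * X p′ ≡
                           - a′ (minFin R (inject₁ q) p′) * X p′ + (I q * b′ q) * X≥ p′
        pointwise p′ = begin
          - a₁ * X p′
            ≡⟨ solve 3 (λ a d y → (:- a) :* y := (:- (a :+ d)) :* y :+ d :* y) refl a₁ δ (X p′) ⟩
          - (a₁ + δ) * X p′ + δ * X p′
            ≡⟨ cong₂ (λ u w → - u * X p′ + w) (a-min-step q p′)
                     (trans (if-*ʳ t (I q * b′ q) (X p′)) (sym (if-*ˡ t (I q * b′ q) (X p′)))) ⟨
          - a′ (minFin R (inject₁ q) p′) * X p′ + (I q * b′ q) * X≥ p′ ∎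
          where
          t = ⌊ suc (toℕ q) ℕ.≤? toℕ p′ ⌋
          a₁ = a′ (minFin R (suc q) p′)
          δ = if t then I q * b′ q else 0#

      isolatePart-step : ∀ q → isolatePart (suc q) ≡ isolatePart (inject₁ q) + - b′ q * Z q
      isolatePart-step q = trans (headSum-step m (λ q′ → - b′ q′ * Z q′) q)
        (cong (λ t → headSum m (λ q′ → - b′ q′ * Z q′) t + - b′ q * Z q) (sym (Fin.toℕ-inject₁ q)))

      step : ∀ q → c (suc q) ≡ c (inject₁ q) - Z q
      step q = *-cancelˡ λ′≢0 (begin
        λ′ * c (suc q)
          ≡⟨ λ′c≡coneRow (suc q) ⟩
        conePart (suc q) + isolatePart (suc q)
          ≡⟨ cong₂ _+_ (conePart-step q) (isolatePart-step q) ⟩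
        (conePart (inject₁ q) + (I q * b′ q) * T₁) + (isolatePart (inject₁ q) + - b′ q * Z q)
          ≡⟨ solve 6 (λ κ ι i β t ζ → (κ :+ (i :* β) :* t) :+ (ι :+ (:- β) :* ζ)
                                     := (κ :+ ι) :+ (i :* (β :* t) :+ (:- β) :* ζ))
                     refl (conePart (inject₁ q)) (isolatePart (inject₁ q)) (I q) (b′ q) T₁ (Z q) ⟩
        coneRow (inject₁ q) + (I q * (b′ q * T₁) + - b′ q * Z q)
          ≡⟨ cong₂ (λ u w → u + (w + - b′ q * Z q)) (λ′c≡coneRow (inject₁ q)) (isolate-block q) ⟨
        λ′ * c (inject₁ q) + (Z q * (b′ q - λ′) + - b′ q * Z q)
          ≡⟨ solve 4 (λ l y ζ β → l :* y :+ (ζ :* (β :- l) :+ (:- β) :* ζ) := l :* (y :- ζ))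
                     refl λ′ (c (inject₁ q)) (Z q) (b′ q) ⟩
        λ′ * (c (inject₁ q) - Z q) ∎)
        where
        open ≡-Reasoning
        T₁ = T c (suc (toℕ q))

      -- In block 0 every minFin is 0 and no isolate block lies below, both by computation.
      first-row : λ′ * c zero ≡ - (a′ zero * T c 0)
      first-row = begin
        λ′ * c zero                               ≡⟨ λ′c≡coneRow zero ⟩
        conePart zero + isolatePart zero          ≡⟨ cong (conePart zero +_) (headSum-zero m (λ q → - b′ q * Z q)) ⟩
        conePart zero + 0#                        ≡⟨ +-identityʳ _ ⟩
        sumFin (suc m) (λ p′ → - a′ zero * X p′)  ≡⟨ sumFin-*ˡ (suc m) (- a′ zero) X ⟩
        - a′ zero * tailSum (suc m) X 0           ≡⟨ cong (- a′ zero *_) (T≡tailSum-X 0) ⟨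
        - a′ zero * T c 0                         ≡⟨ -‿distribˡ-* _ _ ⟨
        - (a′ zero * T c 0)                       ∎
        where open ≡-Reasoning

      solution : Solution (a′ zero) λ′ c Z
      solution = record { first-row = first-row ; step = step ; isolate = isolate-block }

      vanishes-with-cones : (∀ q → λ′ < b′ q) → (∀ p → c p ≡ 0#) → ∀ u → v u ≡ 0#
      vanishes-with-cones λ′<b c≡0 (inj₁ (p , j)) = trans (x≡c p j) (c≡0 p)
      vanishes-with-cones λ′<b c≡0 (inj₂ (q , j)) = *-cancelˡ (0<x⇒x≢0 (x<y⇒0<y-x (λ′<b q))) (begin
        (b′ q - λ′) * z q j       ≡⟨ *-comm _ _ ⟩
        z q j * (b′ q - λ′)       ≡⟨ isolate-vertex q j ⟩
        b′ q * T c (suc (toℕ q))  ≡⟨ cong (b′ q *_) (T-vanishes c c≡0 _) ⟩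
        b′ q * 0#                 ≡⟨ zeroʳ _ ⟩
        0#                        ≡⟨ zeroʳ _ ⟨
        (b′ q - λ′) * 0#          ∎)
        where open ≡-Reasoning

      eigenvector-positive-solution : (∀ q → λ′ < b′ q) → Σ (Vertex m ks is) (λ u → v u ≢ 0#) →
                                      PositiveSolution (a′ zero) λ′
      eigenvector-positive-solution λ′<b (u , vu≢0) =
        positive-solution solution λ′<b (λ c≡0 → vu≢0 (vanishes-with-cones λ′<b c≡0 u))

corollary3p6 : (R : Reals) → let open Reals R in
    (m : ℕ) → (m≥1 : 1 ≤ℕ m) →
    (ks : Fin (suc m) → ℕ) → (∀ p → 1 ≤ℕ ks p) →
    (is : Fin m → ℕ) → (∀ q → 1 ≤ℕ is q) →
    Σ Carrier λ A → ∀ α₁ → 0# < α₁ → A < α₁ →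
      ((∀ λ′ → IsEigenvalue R m ks is (M R m ks is α₁) λ′ → λ′ < 0# →
          λ′ < (- (fromℕ (kTot m ks) * a R m ks is α₁ zero)) + fromℕ (iTot m is))
      × (∀ λ′ → IsEigenvalue R m ks is (M R m ks is α₁) λ′ → 0# < λ′ →
          b R m ks (fromℕ< m≥1) ≤ λ′ × (fromℕ (kTot m ks)) ⁻¹ < b R m ks (fromℕ< m≥1)))
-- Both bounds hold for every α₁ > 0, so the threshold 0 suffices.
corollary3p6 R m@(suc _) 1≤m@(ℕ.s≤s ℕ.z≤n) ks ks-pos is is-pos =
  0# , λ α₁ 0<α₁ _ → negative α₁ , positive α₁ 0<α₁
  where
  open Reals R
  open OrderedField R
  open ThresholdBlocks R ks is ks-pos is-pos

  negative : ∀ α₁ λ′ → IsEigenvalue R m ks is (M R m ks is α₁) λ′ → λ′ < 0# →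
             λ′ < (- (fromℕ (kTot m ks) * a R m ks is α₁ zero)) + fromℕ (iTot m is)
  negative α₁ λ′ (v , nonzero , eigen) λ′<0 rewrite kTot≡k | iTot≡i =
    negative-eigenvalue-bound 1≤m λ′<b (eigenvector-positive-solution λ′<b nonzero)
    where
    open Eigenvector α₁ λ′ (<⇒≢ λ′<0) v eigen
    λ′<b : ∀ q → λ′ < b′ q
    λ′<b q = <-trans λ′<0 (b-pos q)

  positive : ∀ α₁ → 0# < α₁ → ∀ λ′ → IsEigenvalue R m ks is (M R m ks is α₁) λ′ → 0# < λ′ →
             b′ zero ≤ λ′ × (fromℕ (kTot m ks)) ⁻¹ < b′ zero
  positive α₁ 0<α₁ λ′ (v , nonzero , eigen) 0<λ′ rewrite kTot≡k = ≮⇒≥ λ′≮b₀ , k⁻¹<b zero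
    where
    open Eigenvector α₁ λ′ (<⇒≢ 0<λ′ ∘ sym) v eigen
    λ′≮b₀ : ¬ (λ′ < b′ zero)
    λ′≮b₀ λ′<b₀ = positive-eigenvalue-absurd (a-pos 0<α₁) 0<λ′ (eigenvector-positive-solution λ′<b nonzero)
      where
      λ′<b : ∀ q → λ′ < b′ q
      λ′<b q = <-≤-trans λ′<b₀ (b-monotone {q′ = q} ℕ.z≤n)
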